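{- Let $P$ be a disjunctive program. Then every (disjunctive) stable model of $P$ is a minimal founded model of $P$, i.e. $\mathcal{SM}(P) \subseteq \mathcal{MF}(P)$.
   Context: A disjunctive (datalog) rule has the form $A_1 \vee \cdots \vee A_k \leftarrow B_1,\ldots,B_m,\neg C_1,\ldots,\neg C_n$ with $k+m+n>0$, where all $A_i,B_j,C_l$ are function-free atoms $p(t_1,\ldots,t_h)$ whose terms are constants or variables; $Head(r)=\{A_1,\ldots,A_k\}$, $Body(r)=\{B_1,\ldots,B_m,\neg C_1,\ldots,\neg C_n\}$. Rules with empty head ($k=0$) are called denials. A disjunctive program is a finite set of rules; it is positive if it contains no negation and normal if every rule has $k=1$. $U_P$ is the set of constants in $P$, $B_P$ the set of ground atoms built from predicates of $P$ and constants of $U_P$, and $ground(P)$ the set of all ground instances of rules of $P$ over $U_P$. An interpretation is a subset $I\subseteq B_P$; a ground rule $r$ is satisfied by $I$ if some head atom is in $I$ or the body is false in $I$ (so a denial is satisfied iff its body is false). A model is an interpretation satisfying every rule of $ground(P)$; $\mathcal{MM}(P)$ denotes the set of minimal models (w.r.t. set inclusion). For an interpretation $M$, $\frac{P}{M}$ is the positive ground program obtained from $ground(P)$ by deleting every rule containing a literal $\neg a$ with $a\in M$ and deleting all negative literals from the remaining rules. $M$ is a stable model of $P$ iff $M\in\mathcal{MM}(\frac{P}{M})$; $\mathcal{SM}(P)$ is the set of stable models. For a positive program $Q$, $S_Q(M)=\{a\in B_Q \mid \exists r\in ground(Q): a\in Head(r) \wedge Body(r)\subseteq M\}$, and $S_Q^\omega(\emptyset)$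 is its least fixpoint. A model $M$ of $P$ is founded if $M\subseteq S_{\frac{P}{M}}^\omega(\emptyset)$; it is minimal founded if it is a minimal model of $P$ and founded. $\mathcal{MF}(P)$ is the set of minimal founded models. -}

module Defs where

open import Level using (0ℓ)
open import Data.Nat using (ℕ; zero; suc; _+_; _<_)
open import Data.List using (List; []; _∷_; length; map)
open import Data.List.Membership.Propositional using (_∈_)
open import Data.List.Relation.Unary.All using (All)
open import Data.List.Relation.Unary.Any using (Any)
open import Data.Product using (Σ; ∃; _×_; _,_)
open import Data.Sum using (_⊎_)
open import Data.Empty using (⊥)
open import Relation.Nullary using (¬_)
open import Relation.Binary.PropositionalEquality using (_≡_)
open import Relation.Unary using (Pred; _⊆_)

data Term : Set where
  const : ℕ → Term
  var   : ℕ → Term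

-- an atom p(t₁,…,tₕ); a predicate symbol is identified by its name
-- together with its arity h = length of the argument list
record Atom : Set where
  constructor atom
  field
    pred : ℕ
    args : List Term
open Atom public

-- A₁ ∨ … ∨ Aₖ ← B₁,…,Bₘ, ¬C₁,…,¬Cₙ
record Rule : Set where
  constructor rule
  field
    head : List Atom
    pos  : List Atom
    neg  : List Atom
open Rule public

WellFormed : Rule → Set
WellFormed r = 0 < length (head r) + length (pos r) + length (neg r)

Program : Set
Program = List Rule

AtomOf : Rule → Atom → Set
AtomOf r a = a ∈ head r ⊎ (a ∈ pos r ⊎ a ∈ neg r)

InU : Program → ℕ → Set
InU P c = ∃ λ r → r ∈ P × ∃ λ a → AtomOf r a × const c ∈ args a

VarOf : Rule → ℕ → Set
VarOf r x = ∃ λ a → AtomOf r a × var x ∈ args a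

record GAtom : Set where
  constructor gatom
  field
    gpred : ℕ
    gargs : List ℕ
open GAtom public

record GRule : Set where
  constructor grule
  field
    gHead : List GAtom
    gPos  : List GAtom
    gNeg  : List GAtom
open GRule public

InB : Program → GAtom → Set
InB P g = (∃ λ r → r ∈ P × ∃ λ a → AtomOf r a ×
             (pred a ≡ gpred g × length (args a) ≡ length (gargs g)))
          × All (InU P) (gargs g)

instTerm : (ℕ → ℕ) → Term → ℕ
instTerm σ (const c) = c
instTerm σ (var x)   = σ x

instAtom : (ℕ → ℕ) → Atom → GAtom
instAtom σ a = gatom (pred a) (map (instTerm σ) (args a))

instRule : (ℕ → ℕ) → Rule → GRule
instRule σ r = grule (map (instAtom σ) (head r))
                     (map (instAtom σ) (pos r))
                     (map (instAtom σ) (neg r))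

GProgram : Set₁
GProgram = Pred GRule 0ℓ

Ground : Program → GProgram
Ground P g = ∃ λ r → r ∈ P × ∃ λ (σ : ℕ → ℕ) →
               (∀ x → VarOf r x → InU P (σ x)) × g ≡ instRule σ r

Interp : Set₁
Interp = Pred GAtom 0ℓ

IsInterpretation : Program → Interp → Set
IsInterpretation P I = I ⊆ InB P

BodyTrue : Interp → GRule → Set
BodyTrue I g = All I (gPos g) × All (λ c → ¬ I c) (gNeg g)

-- g is satisfied by I: if the body is true then some head atom is in I
-- (for denials: the body is not true)
Satisfies : Interp → GRule → Set
Satisfies I g = BodyTrue I g → Any I (gHead g)

IsModelG : GProgram → Interp → Set
IsModelG Q M = ∀ g → Q g → Satisfies M g

IsMinimalModelG : GProgram → Interp → Set₁
IsMinimalModelG Q M = IsModelG Q M × (∀ (N : Interp) → IsModelG Q N → N ⊆ M → M ⊆ N)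

Reduct : Program → Interp → GProgram
Reduct P M g' = ∃ λ g → Ground P g × All (λ a → ¬ M a) (gNeg g) ×
                  g' ≡ grule (gHead g) (gPos g) []

IsStable : Program → Interp → Set₁
IsStable P M = IsInterpretation P M × IsMinimalModelG (Reduct P M) M

S : GProgram → Interp → Interp
S Q X a = ∃ λ g → Q g × a ∈ gHead g × All X (gPos g)

Siter : GProgram → ℕ → Interp
Siter Q zero    = λ _ → ⊥
Siter Q (suc n) = S Q (Siter Q n)

Sω : GProgram → Interp
Sω Q a = ∃ λ n → Siter Q n a

IsFounded : Program → Interp → Set
IsFounded P M = IsModelG (Ground P) M × M ⊆ Sω (Reduct P M)

IsMinimalFounded : Program → Interp → Set₁
IsMinimalFounded P M = IsInterpretation P M × IsMinimalModelG (Ground P) M × IsFounded P M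

-- The reduct P/M and ground(P) have the same models below M, so a stable model,
-- minimal for P/M, is minimal for ground(P). For foundedness, intersect M with
-- S^ω of the positive program P/M: since S^ω is closed under the rules of P/M,
-- the intersection is again a model of P/M, and minimality of M forces it to be M.
module Submission where

open import Defs
open import Data.List using (List; []; _∷_)
open import Data.List.Relation.Unary.All as All using (All; []; _∷_)
open import Data.List.Relation.Unary.Any using (Any; here; there)
open import Data.Product using (∃; _,_; proj₁; proj₂)
open import Data.Nat using (zero; suc; _≤_; s≤s; _⊔_)
open import Data.Nat.Properties using (m≤m⊔n; m≤n⊔m)
open import Function using (_∘_)
open import Level using (0ℓ)
open import Relation.Binary.PropositionalEquality using (_≡_; refl)
open import Relation.Unary using (Pred; _⊆_; _∩_)

Any-∩-All : ∀ {A : Set} {P Q : Pred A 0ℓ} {xs : List A} →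
            Any P xs → All Q xs → Any (P ∩ Q) xs
Any-∩-All (here p)  (q ∷ _)  = here (p , q)
Any-∩-All (there p) (_ ∷ qs) = there (Any-∩-All p qs)

S-mono : ∀ Q {X Y : Interp} → X ⊆ Y → S Q X ⊆ S Q Y
S-mono Q X⊆Y (g , q , a∈head , pos) = g , q , a∈head , All.map X⊆Y pos

Siter-mono : ∀ Q {m n} → m ≤ n → Siter Q m ⊆ Siter Q n
Siter-mono Q {zero}  _         ()
Siter-mono Q {suc m} (s≤s m≤n) = S-mono Q (Siter-mono Q m≤n)

All-Sω⇒All-Siter : ∀ Q {xs : List GAtom} → All (Sω Q) xs → ∃ λ n → All (Siter Q n) xs
All-Sω⇒All-Siter Q []             = 0 , []
All-Sω⇒All-Siter Q ((k , x) ∷ xs) with All-Sω⇒All-Siter Q xs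
... | n , xs′ = k ⊔ n , Siter-mono Q (m≤m⊔n k n) x ∷ All.map (Siter-mono Q (m≤n⊔m k n)) xs′

Sω-closed : ∀ Q {g} → Q g → All (Sω Q) (gPos g) → All (Sω Q) (gHead g)
Sω-closed Q {g} q pos with All-Sω⇒All-Siter Q pos
... | n , posₙ = All.tabulate λ a∈head → suc n , g , q , a∈head , posₙ

IsPositive : GProgram → Set
IsPositive Q = ∀ {g} → Q g → gNeg g ≡ []

positive-body : ∀ {I} g → gNeg g ≡ [] → All I (gPos g) → BodyTrue I g
positive-body g refl ps = ps , []

minimal-model⊆Sω : ∀ {Q M} → IsPositive Q → IsMinimalModelG Q M → M ⊆ Sω Q
minimal-model⊆Sω {Q} {M} pos (model , minimal) = proj₂ ∘ minimal (M ∩ Sω Q) model∩ proj₁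
  where
  model∩ : IsModelG Q (M ∩ Sω Q)
  model∩ g q (ps , _) =
    Any-∩-All (model g q (positive-body g (pos q) (All.map proj₁ ps)))
              (Sω-closed Q q (All.map proj₂ ps))

Reduct-positive : ∀ P M → IsPositive (Reduct P M)
Reduct-positive P M {.(grule (gHead g) (gPos g) [])} (g , _ , _ , refl) = refl

Reduct-model⇒Ground-model : ∀ {P M} → IsModelG (Reduct P M) M → IsModelG (Ground P) M
Reduct-model⇒Ground-model model g gr (ps , ns) =
  model (grule (gHead g) (gPos g) []) (g , gr , ns , refl) (ps , [])

Ground-model⇒Reduct-model : ∀ {P M N} → N ⊆ M → IsModelG (Ground P) N → IsModelG (Reduct P M) N
Ground-model⇒Reduct-model N⊆M model .(grule (gHead g) (gPos g) []) (g , gr , ns , refl) (ps , _) =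
  model g gr (ps , All.map (λ ¬Ma Na → ¬Ma (N⊆M Na)) ns)

Reduct-minimal⇒Ground-minimal : ∀ {P M} → IsMinimalModelG (Reduct P M) M → IsMinimalModelG (Ground P) M
Reduct-minimal⇒Ground-minimal (model , minimal) =
  Reduct-model⇒Ground-model model ,
  λ N modelN N⊆M → minimal N (Ground-model⇒Reduct-model N⊆M modelN) N⊆M

theorem1 : (P : Program) → All WellFormed P →
           (M : Interp) → IsStable P M → IsMinimalFounded P M
theorem1 P _ M (interpretation , minimalReduct) =
  interpretation , minimalGround , proj₁ minimalGround ,
  minimal-model⊆Sω (Reduct-positive P M) minimalReduct
  where
  minimalGround : IsMinimalModelG (Ground P) M
  minimalGround = Reduct-minimal⇒Ground-minimal minimalReduct
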